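{- Let $p\equiv 1\pmod 4$ be a prime and let $n$ be a positive integer divisible by $p$. Then $n$ is a sum of $k$ squares not divisible by $p$ for some positive integer $k\le 4$.
   Context: For a prime $p$, an integer $n$ is a sum of $k$ squares not divisible by $p$ if there are integers $x_1,\dots,x_k$ with $n=x_1^2+\cdots+x_k^2$ and $\gcd(p,x_1x_2\cdots x_k)=1$. -}

module Defs where

open import Data.Nat as ℕ using (ℕ)
open import Data.Nat.GCD using (gcd)
open import Data.Integer as ℤ using (ℤ; ∣_∣)
open import Data.Fin using (Fin; zero; suc)
open import Data.Product using (∃; _×_)
open import Relation.Binary.PropositionalEquality using (_≡_)

sumℤ : ∀ {k} → (Fin k → ℤ) → ℤ
sumℤ {ℕ.zero} f = ℤ.+ 0
sumℤ {ℕ.suc k} f = f zero ℤ.+ sumℤ (λ i → f (suc i))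

prodℤ : ∀ {k} → (Fin k → ℤ) → ℤ
prodℤ {ℕ.zero} f = ℤ.+ 1
prodℤ {ℕ.suc k} f = f zero ℤ.* prodℤ (λ i → f (suc i))

SumOfSquaresNotDivBy : (p k : ℕ) → ℤ → Set
SumOfSquaresNotDivBy p k n =
  ∃ λ (x : Fin k → ℤ) →
    (n ≡ sumℤ (λ i → x i ℤ.* x i)) × (gcd p ∣ prodℤ x ∣ ≡ 1)

{-# OPTIONS --safe #-}
module Submission where

-- Write p = a² + b² (Fermat) and n = p q with q = y₁² + y₂² + y₃² + y₄² (Lagrange, by Euler's
-- descent), so that n = p (y₁² + y₂²) + p (y₃² + y₄²).  Each nonzero p (s² + t²) is a sum of two
-- squares prime to p: if p ∤ s or p ∤ t, then one of the two Brahmagupta–Fibonacci forms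
-- (as ∓ bt)² + (at ± bs)² of (a² + b²)(s² + t²) has both terms prime to p, because p is odd;
-- if p divides s and t, strip the factor p² = (a² − b²)² + (2ab)² and recurse.
-- Fermat's theorem comes from Zagier's involution of the finite set {x² + 4yz = p}: its only fixed
-- point is (1, 1, (p − 1)/4), so the set has odd size and the involution (x, y, z) ↦ (x, z, y) has a
-- fixed point too, whence p = x² + (2y)².

open import Defs using (sumℤ; prodℤ; SumOfSquaresNotDivBy)
open import Data.Fin.Base using (Fin; zero; suc; toℕ; fromℕ<; splitAt; join)
import Data.Fin.Base as Fin
import Data.Fin.Properties as Fin
import Data.Integer.Base as ℤ
import Data.Integer.Properties as ℤ
import Data.Integer.DivMod as ℤ
import Data.Nat.Base as ℕ
import Data.Nat.Properties as ℕ
import Data.Nat.Divisibility as ℕ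
import Data.Nat.DivMod as ℕ
import Data.Nat.Tactic.RingSolver as ℕ
open import Data.Nat.Base using (ℕ; zero; suc; z≤n; s≤s)
open import Data.Nat.GCD using (gcd; gcd[m,n]∣m; gcd[m,n]∣n)
open import Data.Nat.Induction using (<-wellFounded)
open import Data.Nat.ListAction using (product)
open import Data.Nat.Primality
  using (Prime; euclidsLemma; prime⇒irreducible; prime⇒nonTrivial; prime⇒nonZero; prime[2]; ¬prime[1])
open import Data.Nat.Primality.Factorisation using (factorise; PrimeFactorisation)
open import Data.List.Base using (List; []; _∷_; length; filter; upTo; cartesianProduct)
open import Data.List.Membership.Propositional using (_∈_; find)
open import Data.List.Membership.Propositional.Properties using (∈-filter⁺; ∈-filter⁻; ∈-cartesianProduct⁺; ∈-upTo⁺)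
open import Data.List.Properties using (filter-all)
open import Data.List.Relation.Unary.All using (All; []; _∷_)
import Data.List.Relation.Unary.All as All
open import Data.List.Relation.Unary.Any using (here; there; any?)
import Data.List.Relation.Unary.Any as Any
open import Data.List.Relation.Unary.Unique.Propositional using (Unique; []; _∷_)
import Data.List.Relation.Unary.Unique.Propositional.Properties as Unique
open import Data.Product using (∃; ∃₂; _×_; _,_; proj₁; proj₂)
open import Data.Product.Properties using (≡-dec)
open import Data.Sum using (_⊎_; inj₁; inj₂; [_,_]; reduce)
open import Function using (_∘_)
open import Induction.WellFounded using (Acc; acc)
open import Relation.Binary.Definitions using (DecidableEquality)
open import Relation.Binary.PropositionalEquality
  using (_≡_; _≢_; refl; sym; trans; cong; cong₂; subst; module ≡-Reasoning)
open import Relation.Nullary using (¬_; yes; no; ¬?; contradiction)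
open import Relation.Unary using (Decidable)

module PrimeDivisibility where

  open import Data.Integer.Base using (ℤ; +_; _+_; _*_)
  open import Data.Integer.Divisibility.Signed
    using (_∣_; divides; ∣⇒∣ᵤ; ∣ᵤ⇒∣; ∣-trans; ∣m∣n⇒∣m+n; ∣m+n∣m⇒∣n; ∣m⇒∣m*n; *-monoʳ-∣; *-monoˡ-∣; *-cancelˡ-∣)

  1<m<p⇒m∤p : ∀ {p m} → Prime p → 1 ℕ.< m → m ℕ.< p → ¬ m ℕ.∣ p
  1<m<p⇒m∤p p-prime 1<m m<p m∣p with prime⇒irreducible p-prime m∣p
  ... | inj₁ refl = ℕ.<-irrefl refl 1<m
  ... | inj₂ refl = ℕ.<-irrefl refl m<p

  prime-factor≡1 : ∀ {p m n} → Prime p → m ℕ.* n ≡ p → m ≡ 1 ⊎ n ≡ 1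
  prime-factor≡1 {p} {m} {n} p-prime mn≡p with prime⇒irreducible p-prime (ℕ.divides n (trans (sym mn≡p) (ℕ.*-comm m n)))
  ... | inj₁ m≡1 = inj₁ m≡1
  ... | inj₂ refl = inj₂ (ℕ.*-cancelˡ-≡ n 1 m {{prime⇒nonZero p-prime}} (trans mn≡p (sym (ℕ.*-identityʳ m))))

  prime-∣-* : ∀ {p} → Prime p → ∀ x y → + p ∣ x * y → + p ∣ x ⊎ + p ∣ y
  prime-∣-* p-prime x y p∣xy
    with euclidsLemma ℤ.∣ x ∣ ℤ.∣ y ∣ p-prime (subst (_ ℕ.∣_) (ℤ.abs-* x y) (∣⇒∣ᵤ p∣xy))
  ... | inj₁ p∣x = inj₁ (∣ᵤ⇒∣ p∣x)
  ... | inj₂ p∣y = inj₂ (∣ᵤ⇒∣ p∣y)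

  prime-∤-* : ∀ {p} → Prime p → ∀ {x y} → ¬ + p ∣ x → ¬ + p ∣ y → ¬ + p ∣ x * y
  prime-∤-* p-prime {x} {y} p∤x p∤y p∣xy with prime-∣-* p-prime x y p∣xy
  ... | inj₁ p∣x = p∤x p∣x
  ... | inj₂ p∣y = p∤y p∣y

  prime-∣-square : ∀ {p} → Prime p → ∀ {x} → + p ∣ x * x → + p ∣ x
  prime-∣-square p-prime {x} p∣x² = reduce (prime-∣-* p-prime x x p∣x²)

  prime-∣-*-cancelˡ : ∀ {p} → Prime p → ∀ {x y} → ¬ + p ∣ x → + p ∣ x * y → + p ∣ y
  prime-∣-*-cancelˡ p-prime {x} {y} p∤x p∣xy with prime-∣-* p-prime x y p∣xy
  ... | inj₁ p∣x = contradiction p∣x p∤x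
  ... | inj₂ p∣y = p∣y

  prime-∤1 : ∀ {p} → Prime p → ¬ + p ∣ + 1
  prime-∤1 p-prime p∣1 = ¬prime[1] (subst Prime (ℕ.∣1⇒≡1 (∣⇒∣ᵤ p∣1)) p-prime)

  prime-∤⇒gcd≡1 : ∀ {p} → Prime p → ∀ {z} → ¬ + p ∣ z → gcd p ℤ.∣ z ∣ ≡ 1
  prime-∤⇒gcd≡1 {p} p-prime {z} p∤z with prime⇒irreducible p-prime (gcd[m,n]∣m p ℤ.∣ z ∣)
  ... | inj₁ gcd≡1 = gcd≡1
  ... | inj₂ gcd≡p = contradiction (∣ᵤ⇒∣ (subst (ℕ._∣ ℤ.∣ z ∣) gcd≡p (gcd[m,n]∣n p ℤ.∣ z ∣))) p∤z

  prime-∤-prodℤ : ∀ {p} → Prime p → ∀ {k} (x : Fin k → ℤ) → (∀ i → ¬ + p ∣ x i) → ¬ + p ∣ prodℤ x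
  prime-∤-prodℤ p-prime {zero}  x _   = prime-∤1 p-prime
  prime-∤-prodℤ p-prime {suc k} x p∤x = prime-∤-* p-prime (p∤x zero) (prime-∤-prodℤ p-prime (x ∘ suc) (p∤x ∘ suc))

  sumOfSquaresNotDivBy : ∀ {p} → Prime p → ∀ {k n} (x : Fin k → ℤ) →
    n ≡ sumℤ (λ i → x i * x i) → (∀ i → ¬ + p ∣ x i) → SumOfSquaresNotDivBy p k n
  sumOfSquaresNotDivBy p-prime x n≡ p∤x = x , n≡ , prime-∤⇒gcd≡1 p-prime (prime-∤-prodℤ p-prime x p∤x)

  prime-sum-of-two-squares⇒∤ : ∀ {p} → Prime p → ∀ {a b} → + p ≡ a * a + b * b → ¬ + p ∣ a
  prime-sum-of-two-squares⇒∤ {p} p-prime {a} {b} p≡a²+b² p∣a = prime-∤1 p-prime (*-cancelˡ-∣ P {{prime⇒nonZero p-prime}} P*P∣P)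
    where
    P = + p
    P∣b : P ∣ b
    P∣b = prime-∣-square p-prime (∣m+n∣m⇒∣n (subst (P ∣_) p≡a²+b² (divides (+ 1) (sym (ℤ.*-identityˡ P)))) (∣m⇒∣m*n a p∣a))
    square-∣ : ∀ {x} → P ∣ x → P * P ∣ x * x
    square-∣ {x} P∣x = ∣-trans (*-monoʳ-∣ P P∣x) (*-monoˡ-∣ x P∣x)
    P*P∣P : P * P ∣ P * + 1
    P*P∣P = subst (P * P ∣_) (trans (sym p≡a²+b²) (sym (ℤ.*-identityʳ P))) (∣m∣n⇒∣m+n (square-∣ p∣a) (square-∣ P∣b))

module FourSquares where

  open import Data.Integer.Base using (ℤ; +_; -[1+_]; _+_; _*_; _-_; -_)
  open import Data.Integer.Divisibility.Signed using (_∣_; divides; _∣?_; ∣⇒∣ᵤ; ∣m∣n⇒∣m-n; ∣m+n∣m⇒∣n)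
  open import Data.Integer.Tactic.RingSolver using (solve-∀)
  open PrimeDivisibility using (1<m<p⇒m∤p; prime-∣-*; prime-∣-square)

  square≡∣∣² : ∀ y → y * y ≡ + (ℤ.∣ y ∣ ℕ.* ℤ.∣ y ∣)
  square≡∣∣² (+ n)    = sym (ℤ.pos-* n n)
  square≡∣∣² -[1+ n ] = refl

  SumOfFourSquares : ℤ → Set
  SumOfFourSquares n = ∃₂ λ a b → ∃₂ λ c d → n ≡ a * a + b * b + c * c + d * d

  euler-four-square-identity : ∀ a b c d e f g h →
    (a * a + b * b + c * c + d * d) * (e * e + f * f + g * g + h * h) ≡
      (a * e + b * f + c * g + d * h) * (a * e + b * f + c * g + d * h) +
      (a * f - b * e + c * h - d * g) * (a * f - b * e + c * h - d * g) +
      (a * g - b * h - c * e + d * f) * (a * g - b * h - c * e + d * f) +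
      (a * h + b * g - c * f - d * e) * (a * h + b * g - c * f - d * e)
  euler-four-square-identity = solve-∀

  sumOfFourSquares-* : ∀ {m n} → SumOfFourSquares m → SumOfFourSquares n → SumOfFourSquares (m * n)
  sumOfFourSquares-* (a , b , c , d , refl) (e , f , g , h , refl) =
    a * e + b * f + c * g + d * h , a * f - b * e + c * h - d * g ,
    a * g - b * h - c * e + d * f , a * h + b * g - c * f - d * e ,
    euler-four-square-identity a b c d e f g h

  even-or-odd : ∀ x → + 2 ∣ x ⊎ + 2 ∣ x + + 1
  even-or-odd x with x ℤ.% + 2 | ℤ.n%d<d x (+ 2) | ℤ.a≡a%n+[a/n]*n x (+ 2)
  ... | 0 | _ | x≡0+k*2 = inj₁ (divides (x ℤ./ + 2) (trans x≡0+k*2 (ℤ.+-identityˡ _)))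
  ... | 1 | _ | x≡1+k*2 = inj₂ (divides (x ℤ./ + 2 + + 1) (trans (cong (_+ + 1) x≡1+k*2) (shift (x ℤ./ + 2))))
    where
    shift : ∀ k → + 1 + k * + 2 + + 1 ≡ (k + + 1) * + 2
    shift = solve-∀
  ... | suc (suc _) | s≤s (s≤s ()) | _

  odd-odd⇒even-difference : ∀ {x y} → ¬ + 2 ∣ x → ¬ + 2 ∣ y → + 2 ∣ x - y
  odd-odd⇒even-difference {x} {y} 2∤x 2∤y with even-or-odd x | even-or-odd y
  ... | inj₁ 2∣x | _ = contradiction 2∣x 2∤x
  ... | _ | inj₁ 2∣y = contradiction 2∣y 2∤y
  ... | inj₂ 2∣x+1 | inj₂ 2∣y+1 = subst (+ 2 ∣_) (cancel x y) (∣m∣n⇒∣m-n 2∣x+1 2∣y+1)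
    where
    cancel : ∀ x y → x + + 1 - (y + + 1) ≡ x - y
    cancel = solve-∀

  sum-of-two-squares-halves : ∀ x y → + 2 ∣ x - y → ∃₂ λ s t → x * x + y * y ≡ + 2 * (s * s + t * t)
  sum-of-two-squares-halves x y (divides k x-y≡k*2) = y + k , k , (begin
    x * x + y * y                          ≡⟨ through-difference x y ⟩
    (x - y + y) * (x - y + y) + y * y      ≡⟨ cong (λ z → (z + y) * (z + y) + y * y) x-y≡k*2 ⟩
    (k * + 2 + y) * (k * + 2 + y) + y * y  ≡⟨ halve y k ⟩
    + 2 * ((y + k) * (y + k) + k * k)      ∎)
    where
    open ≡-Reasoning
    through-difference : ∀ x y → x * x + y * y ≡ (x - y + y) * (x - y + y) + y * y
    through-difference = solve-∀
    halve : ∀ y k → (k * + 2 + y) * (k * + 2 + y) + y * y ≡ + 2 * ((y + k) * (y + k) + k * k)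
    halve = solve-∀

  even-difference⇒even-sum-of-two-squares : ∀ x y → + 2 ∣ x - y → + 2 ∣ x * x + y * y
  even-difference⇒even-sum-of-two-squares x y 2∣x-y with s , t , x²+y²≡ ← sum-of-two-squares-halves x y 2∣x-y =
    divides (s * s + t * t) (trans x²+y²≡ (ℤ.*-comm (+ 2) _))

  even-sum-of-two-squares⇒even-difference : ∀ x y → + 2 ∣ x * x + y * y → + 2 ∣ x - y
  even-sum-of-two-squares⇒even-difference x y 2∣x²+y² =
    prime-∣-square prime[2] (subst (+ 2 ∣_) (square-of-difference x y) (∣m∣n⇒∣m-n 2∣x²+y² (divides (x * y) refl)))
    where
    square-of-difference : ∀ x y → x * x + y * y - x * y * + 2 ≡ (x - y) * (x - y)
    square-of-difference = solve-∀

  private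
    sumOfFourSquares-half-paired : ∀ {a b c d m} → + 2 ∣ a - b →
      a * a + b * b + c * c + d * d ≡ + 2 * m → SumOfFourSquares m
    sumOfFourSquares-half-paired {a} {b} {c} {d} {m} 2∣a-b sum≡2m =
      combine (sum-of-two-squares-halves a b 2∣a-b) (sum-of-two-squares-halves c d 2∣c-d)
      where
      open ≡-Reasoning
      regroup : ∀ a b c d → a * a + b * b + c * c + d * d ≡ (a * a + b * b) + (c * c + d * d)
      regroup = solve-∀
      factor : ∀ s t u v → + 2 * (s * s + t * t) + + 2 * (u * u + v * v) ≡ + 2 * (s * s + t * t + u * u + v * v)
      factor = solve-∀

      2∣c-d : + 2 ∣ c - d
      2∣c-d = even-sum-of-two-squares⇒even-difference c d
        (∣m+n∣m⇒∣n (subst (+ 2 ∣_) (regroup a b c d) (divides m (trans sum≡2m (ℤ.*-comm (+ 2) m))))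
                   (even-difference⇒even-sum-of-two-squares a b 2∣a-b))

      combine : (∃₂ λ s t → a * a + b * b ≡ + 2 * (s * s + t * t)) →
                (∃₂ λ u v → c * c + d * d ≡ + 2 * (u * u + v * v)) → SumOfFourSquares m
      combine (s , t , a²+b²≡) (u , v , c²+d²≡) = s , t , u , v , ℤ.*-cancelˡ-≡ (+ 2) m _ (begin
        + 2 * m                                         ≡⟨ sym sum≡2m ⟩
        a * a + b * b + c * c + d * d                   ≡⟨ regroup a b c d ⟩
        (a * a + b * b) + (c * c + d * d)               ≡⟨ cong₂ _+_ a²+b²≡ c²+d²≡ ⟩
        + 2 * (s * s + t * t) + + 2 * (u * u + v * v)   ≡⟨ factor s t u v ⟩
        + 2 * (s * s + t * t + u * u + v * v)           ∎)

  sumOfFourSquares-half : ∀ {m} → SumOfFourSquares (+ 2 * m) → SumOfFourSquares m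
  sumOfFourSquares-half (a , b , c , d , 2m≡) with + 2 ∣? a - b | + 2 ∣? a - c
  ... | yes 2∣a-b | _        = sumOfFourSquares-half-paired {a} {b} {c} {d} 2∣a-b (sym 2m≡)
  ... | no _      | yes 2∣a-c = sumOfFourSquares-half-paired {a} {c} {b} {d} 2∣a-c (trans (swap a b c d) (sym 2m≡))
    where
    swap : ∀ a b c d → a * a + c * c + b * b + d * d ≡ a * a + b * b + c * c + d * d
    swap = solve-∀
  ... | no 2∤a-b  | no 2∤a-c  = sumOfFourSquares-half-paired {b} {c} {a} {d} 2∣b-c (trans (rotate a b c d) (sym 2m≡))
    where
    2∣b-c : + 2 ∣ b - c
    2∣b-c = subst (+ 2 ∣_) (difference a b c) (odd-odd⇒even-difference 2∤a-c 2∤a-b)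
      where
      difference : ∀ a b c → a - c - (a - b) ≡ b - c
      difference = solve-∀
    rotate : ∀ a b c d → b * b + c * c + a * a + d * d ≡ a * a + b * b + c * c + d * d
    rotate = solve-∀

  centred-residue : ∀ h x → ∃₂ λ y t → x ≡ y + t * + suc (h ℕ.+ h) × ℤ.∣ y ∣ ℕ.≤ h
  centred-residue h x
    with x ℤ.% + suc (h ℕ.+ h) | ℤ.n%d<d x (+ suc (h ℕ.+ h)) | ℤ.a≡a%n+[a/n]*n x (+ suc (h ℕ.+ h))
  ... | r | r<m | x≡r+kM with r ℕ.≤? h
  ...   | yes r≤h = + r , x ℤ./ + suc (h ℕ.+ h) , x≡r+kM , r≤h
  ...   | no r≰h  = - + (m ℕ.∸ r) , x ℤ./ M + + 1 , trans x≡r+kM (begin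
    + r + k * M                    ≡⟨ wrap (+ r) k M ⟩
    - (M - + r) + (k + + 1) * M    ≡⟨ cong (λ z → - z + (k + + 1) * M) m∸r≡M-r ⟨
    - + (m ℕ.∸ r) + (k + + 1) * M  ∎) , ∣y∣≤h
    where
    open ≡-Reasoning
    m = suc (h ℕ.+ h)
    M = + m
    k = x ℤ./ M
    wrap : ∀ r k M → r + k * M ≡ - (M - r) + (k + + 1) * M
    wrap = solve-∀
    m∸r≡M-r : + (m ℕ.∸ r) ≡ M - + r
    m∸r≡M-r = trans (sym (ℤ.⊖-≥ (ℕ.<⇒≤ r<m))) (sym (ℤ.m-n≡m⊖n m r))
    ∣y∣≤h : ℤ.∣ - + (m ℕ.∸ r) ∣ ℕ.≤ h
    ∣y∣≤h = subst (ℕ._≤ h) (sym (ℤ.∣-i∣≡∣i∣ (+ (m ℕ.∸ r))))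
              (ℕ.≤-trans (ℕ.∸-monoʳ-≤ m (ℕ.≰⇒> r≰h)) (ℕ.≤-reflexive (ℕ.m+n∸m≡n h h)))

  -- In Euler's identity for xᵢ = yᵢ + tᵢ M and yᵢ every term is divisible by M.
  euler-descent : ∀ M Q R y₁ y₂ y₃ y₄ t₁ t₂ t₃ t₄ .{{_ : ℤ.NonZero M}} →
    M * Q ≡ (y₁ + t₁ * M) * (y₁ + t₁ * M) + (y₂ + t₂ * M) * (y₂ + t₂ * M) +
            (y₃ + t₃ * M) * (y₃ + t₃ * M) + (y₄ + t₄ * M) * (y₄ + t₄ * M) →
    y₁ * y₁ + y₂ * y₂ + y₃ * y₃ + y₄ * y₄ ≡ M * R →
    SumOfFourSquares (Q * R)
  euler-descent M Q R y₁ y₂ y₃ y₄ t₁ t₂ t₃ t₄ MQ≡ MR≡ =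
    R + A , B , C , D , ℤ.*-cancelˡ-≡ M _ _ (ℤ.*-cancelˡ-≡ M _ _ (begin
      M * (M * (Q * R))                                                  ≡⟨ interchange M Q R ⟩
      (M * Q) * (M * R)                                                  ≡⟨ cong₂ _*_ MQ≡ (sym MR≡) ⟩
      _                                                                  ≡⟨ euler-congruent M y₁ y₂ y₃ y₄ t₁ t₂ t₃ t₄ ⟩
      (N + M * A) * (N + M * A) + (M * B) * (M * B) + (M * C) * (M * C) + (M * D) * (M * D)
                                                                         ≡⟨ cong (λ n → (n + M * A) * (n + M * A) + (M * B) * (M * B) + (M * C) * (M * C) + (M * D) * (M * D)) MR≡ ⟩
      (M * R + M * A) * (M * R + M * A) + (M * B) * (M * B) + (M * C) * (M * C) + (M * D) * (M * D)
                                                                         ≡⟨ factor M R A B C D ⟩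
      M * (M * ((R + A) * (R + A) + B * B + C * C + D * D))              ∎))
    where
    open ≡-Reasoning
    N = y₁ * y₁ + y₂ * y₂ + y₃ * y₃ + y₄ * y₄
    A = t₁ * y₁ + t₂ * y₂ + t₃ * y₃ + t₄ * y₄
    B = t₁ * y₂ - t₂ * y₁ + t₃ * y₄ - t₄ * y₃
    C = t₁ * y₃ - t₂ * y₄ - t₃ * y₁ + t₄ * y₂
    D = t₁ * y₄ + t₂ * y₃ - t₃ * y₂ - t₄ * y₁
    interchange : ∀ M Q R → M * (M * (Q * R)) ≡ (M * Q) * (M * R)
    interchange = solve-∀
    factor : ∀ M R A B C D → (M * R + M * A) * (M * R + M * A) + (M * B) * (M * B) + (M * C) * (M * C) + (M * D) * (M * D)
                             ≡ M * (M * ((R + A) * (R + A) + B * B + C * C + D * D))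
    factor = solve-∀
    euler-congruent : ∀ M y₁ y₂ y₃ y₄ t₁ t₂ t₃ t₄ →
      ((y₁ + t₁ * M) * (y₁ + t₁ * M) + (y₂ + t₂ * M) * (y₂ + t₂ * M) +
       (y₃ + t₃ * M) * (y₃ + t₃ * M) + (y₄ + t₄ * M) * (y₄ + t₄ * M)) *
      (y₁ * y₁ + y₂ * y₂ + y₃ * y₃ + y₄ * y₄) ≡
      (y₁ * y₁ + y₂ * y₂ + y₃ * y₃ + y₄ * y₄ + M * (t₁ * y₁ + t₂ * y₂ + t₃ * y₃ + t₄ * y₄)) *
      (y₁ * y₁ + y₂ * y₂ + y₃ * y₃ + y₄ * y₄ + M * (t₁ * y₁ + t₂ * y₂ + t₃ * y₃ + t₄ * y₄)) +
      (M * (t₁ * y₂ - t₂ * y₁ + t₃ * y₄ - t₄ * y₃)) * (M * (t₁ * y₂ - t₂ * y₁ + t₃ * y₄ - t₄ * y₃)) +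
      (M * (t₁ * y₃ - t₂ * y₄ - t₃ * y₁ + t₄ * y₂)) * (M * (t₁ * y₃ - t₂ * y₄ - t₃ * y₁ + t₄ * y₂)) +
      (M * (t₁ * y₄ + t₂ * y₃ - t₃ * y₂ - t₄ * y₁)) * (M * (t₁ * y₄ + t₂ * y₃ - t₃ * y₂ - t₄ * y₁))
    euler-congruent = solve-∀

  four-small-squares< : ∀ {a b c d h} → a ℕ.≤ h → b ℕ.≤ h → c ℕ.≤ h → d ℕ.≤ h →
    a ℕ.* a ℕ.+ b ℕ.* b ℕ.+ c ℕ.* c ℕ.+ d ℕ.* d ℕ.< suc (h ℕ.+ h) ℕ.* suc (h ℕ.+ h)
  four-small-squares< {h = h} a≤h b≤h c≤h d≤h = ℕ.≤-<-trans
    (ℕ.+-mono-≤ (ℕ.+-mono-≤ (ℕ.+-mono-≤ (ℕ.*-mono-≤ a≤h a≤h) (ℕ.*-mono-≤ b≤h b≤h)) (ℕ.*-mono-≤ c≤h c≤h)) (ℕ.*-mono-≤ d≤h d≤h))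
    (subst (h ℕ.* h ℕ.+ h ℕ.* h ℕ.+ h ℕ.* h ℕ.+ h ℕ.* h ℕ.<_) (sym (square-of-odd h))
      (s≤s (ℕ.m≤m+n _ (h ℕ.+ h ℕ.+ h ℕ.+ h))))
    where
    square-of-odd : ∀ h → suc (h ℕ.+ h) ℕ.* suc (h ℕ.+ h) ≡ suc (h ℕ.* h ℕ.+ h ℕ.* h ℕ.+ h ℕ.* h ℕ.+ h ℕ.* h ℕ.+ (h ℕ.+ h ℕ.+ h ℕ.+ h))
    square-of-odd = ℕ.solve-∀

  nonNegative-quotient : ∀ m R S → + suc m * R ≡ + S → ∃ λ r → R ≡ + r × S ≡ suc m ℕ.* r
  nonNegative-quotient m (+ r) S mR≡S = r , refl , ℤ.+-injective (trans (sym mR≡S) (sym (ℤ.pos-* (suc m) r)))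

  private
    expand-residues : ∀ M y₁ y₂ y₃ y₄ t₁ t₂ t₃ t₄ →
      (y₁ + t₁ * M) * (y₁ + t₁ * M) + (y₂ + t₂ * M) * (y₂ + t₂ * M) +
      (y₃ + t₃ * M) * (y₃ + t₃ * M) + (y₄ + t₄ * M) * (y₄ + t₄ * M) ≡
      y₁ * y₁ + y₂ * y₂ + y₃ * y₃ + y₄ * y₄ +
      M * (+ 2 * (y₁ * t₁ + y₂ * t₂ + y₃ * t₃ + y₄ * t₄) + M * (t₁ * t₁ + t₂ * t₂ + t₃ * t₃ + t₄ * t₄))
    expand-residues = solve-∀

    pos-sum-of-squares : ∀ y₁ y₂ y₃ y₄ → let a₁ = ℤ.∣ y₁ ∣ ; a₂ = ℤ.∣ y₂ ∣ ; a₃ = ℤ.∣ y₃ ∣ ; a₄ = ℤ.∣ y₄ ∣ in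
      + (a₁ ℕ.* a₁ ℕ.+ a₂ ℕ.* a₂ ℕ.+ a₃ ℕ.* a₃ ℕ.+ a₄ ℕ.* a₄) ≡ y₁ * y₁ + y₂ * y₂ + y₃ * y₃ + y₄ * y₄
    pos-sum-of-squares y₁ y₂ y₃ y₄ = begin
      + (s₁ ℕ.+ s₂ ℕ.+ s₃ ℕ.+ s₄)        ≡⟨ ℤ.pos-+ (s₁ ℕ.+ s₂ ℕ.+ s₃) s₄ ⟩
      + (s₁ ℕ.+ s₂ ℕ.+ s₃) + + s₄         ≡⟨ cong (_+ + s₄) (ℤ.pos-+ (s₁ ℕ.+ s₂) s₃) ⟩
      + (s₁ ℕ.+ s₂) + + s₃ + + s₄         ≡⟨ cong (λ z → z + + s₃ + + s₄) (ℤ.pos-+ s₁ s₂) ⟩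
      + s₁ + + s₂ + + s₃ + + s₄           ≡⟨ squares ⟨
      y₁ * y₁ + y₂ * y₂ + y₃ * y₃ + y₄ * y₄ ∎
      where
      open ≡-Reasoning
      s₁ = ℤ.∣ y₁ ∣ ℕ.* ℤ.∣ y₁ ∣ ; s₂ = ℤ.∣ y₂ ∣ ℕ.* ℤ.∣ y₂ ∣ ; s₃ = ℤ.∣ y₃ ∣ ℕ.* ℤ.∣ y₃ ∣ ; s₄ = ℤ.∣ y₄ ∣ ℕ.* ℤ.∣ y₄ ∣
      squares : y₁ * y₁ + y₂ * y₂ + y₃ * y₃ + y₄ * y₄ ≡ + s₁ + + s₂ + + s₃ + + s₄
      squares = cong₂ _+_ (cong₂ _+_ (cong₂ _+_ (square≡∣∣² y₁) (square≡∣∣² y₂)) (square≡∣∣² y₃)) (square≡∣∣² y₄)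

    sum-of-four-squares≡0 : ∀ a b c d → a ℕ.* a ℕ.+ b ℕ.* b ℕ.+ c ℕ.* c ℕ.+ d ℕ.* d ≡ 0 →
      a ≡ 0 × b ≡ 0 × c ≡ 0 × d ≡ 0
    sum-of-four-squares≡0 zero zero zero zero _ = refl , refl , refl , refl

    zero-residues⇒∣ : ∀ M Q y₁ y₂ y₃ y₄ t₁ t₂ t₃ t₄ .{{_ : ℤ.NonZero M}} →
      y₁ ≡ + 0 → y₂ ≡ + 0 → y₃ ≡ + 0 → y₄ ≡ + 0 →
      M * Q ≡ (y₁ + t₁ * M) * (y₁ + t₁ * M) + (y₂ + t₂ * M) * (y₂ + t₂ * M) +
              (y₃ + t₃ * M) * (y₃ + t₃ * M) + (y₄ + t₄ * M) * (y₄ + t₄ * M) →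
      M ∣ Q
    zero-residues⇒∣ M Q _ _ _ _ t₁ t₂ t₃ t₄ refl refl refl refl MQ≡ =
      divides (t₁ * t₁ + t₂ * t₂ + t₃ * t₃ + t₄ * t₄) (ℤ.*-cancelˡ-≡ M _ _ (trans MQ≡ (multiples M t₁ t₂ t₃ t₄)))
      where
      multiples : ∀ M t₁ t₂ t₃ t₄ →
        (+ 0 + t₁ * M) * (+ 0 + t₁ * M) + (+ 0 + t₂ * M) * (+ 0 + t₂ * M) +
        (+ 0 + t₃ * M) * (+ 0 + t₃ * M) + (+ 0 + t₄ * M) * (+ 0 + t₄ * M) ≡
        M * ((t₁ * t₁ + t₂ * t₂ + t₃ * t₃ + t₄ * t₄) * M)
      multiples = solve-∀

    residue-squares-multiple : ∀ M Q y₁ y₂ y₃ y₄ t₁ t₂ t₃ t₄ →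
      M * Q ≡ (y₁ + t₁ * M) * (y₁ + t₁ * M) + (y₂ + t₂ * M) * (y₂ + t₂ * M) +
              (y₃ + t₃ * M) * (y₃ + t₃ * M) + (y₄ + t₄ * M) * (y₄ + t₄ * M) →
      ∃ λ R → y₁ * y₁ + y₂ * y₂ + y₃ * y₃ + y₄ * y₄ ≡ M * R
    residue-squares-multiple M Q y₁ y₂ y₃ y₄ t₁ t₂ t₃ t₄ MQ≡ = Q - W , (begin
      y₁ * y₁ + y₂ * y₂ + y₃ * y₃ + y₄ * y₄                  ≡⟨ cancel _ (M * W) ⟨
      y₁ * y₁ + y₂ * y₂ + y₃ * y₃ + y₄ * y₄ + M * W - M * W  ≡⟨ cong (_- M * W) (trans MQ≡ (expand-residues M y₁ y₂ y₃ y₄ t₁ t₂ t₃ t₄)) ⟨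
      M * Q - M * W                                          ≡⟨ distrib M Q W ⟨
      M * (Q - W)                                            ∎)
      where
      open ≡-Reasoning
      W = + 2 * (y₁ * t₁ + y₂ * t₂ + y₃ * t₃ + y₄ * t₄) + M * (t₁ * t₁ + t₂ * t₂ + t₃ * t₃ + t₄ * t₄)
      distrib : ∀ M Q W → M * (Q - W) ≡ M * Q - M * W
      distrib = solve-∀
      cancel : ∀ N X → N + X - X ≡ N
      cancel = solve-∀

    -- Σ yᵢ² ≡ 0 (mod m) and Σ yᵢ² < m², so Σ yᵢ² = m r with r < m; and r = 0 would give m ∣ q.
    descent-from-residues : ∀ {q h} → Prime q → 1 ℕ.≤ h → suc (h ℕ.+ h) ℕ.< q →
      ∀ y₁ y₂ y₃ y₄ t₁ t₂ t₃ t₄ → ℤ.∣ y₁ ∣ ℕ.≤ h → ℤ.∣ y₂ ∣ ℕ.≤ h → ℤ.∣ y₃ ∣ ℕ.≤ h → ℤ.∣ y₄ ∣ ℕ.≤ h →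
      let M = + suc (h ℕ.+ h) in
      M * + q ≡ (y₁ + t₁ * M) * (y₁ + t₁ * M) + (y₂ + t₂ * M) * (y₂ + t₂ * M) +
                (y₃ + t₃ * M) * (y₃ + t₃ * M) + (y₄ + t₄ * M) * (y₄ + t₄ * M) →
      ∃ λ r → 1 ℕ.≤ r × r ℕ.< suc (h ℕ.+ h) × SumOfFourSquares (+ r * + q)
    descent-from-residues {q} {h} q-prime 1≤h m<q y₁ y₂ y₃ y₄ t₁ t₂ t₃ t₄ ∣y₁∣≤h ∣y₂∣≤h ∣y₃∣≤h ∣y₄∣≤h Mq≡ =
      conclude (nonNegative-quotient (h ℕ.+ h) R S (trans (sym N≡MR) (sym (pos-sum-of-squares y₁ y₂ y₃ y₄))))
      where
      m = suc (h ℕ.+ h)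
      M = + m
      Q = + q
      R = proj₁ (residue-squares-multiple M Q y₁ y₂ y₃ y₄ t₁ t₂ t₃ t₄ Mq≡)
      N≡MR = proj₂ (residue-squares-multiple M Q y₁ y₂ y₃ y₄ t₁ t₂ t₃ t₄ Mq≡)
      a₁ = ℤ.∣ y₁ ∣ ; a₂ = ℤ.∣ y₂ ∣ ; a₃ = ℤ.∣ y₃ ∣ ; a₄ = ℤ.∣ y₄ ∣
      S = a₁ ℕ.* a₁ ℕ.+ a₂ ℕ.* a₂ ℕ.+ a₃ ℕ.* a₃ ℕ.+ a₄ ℕ.* a₄
      conclude : (∃ λ r → R ≡ + r × S ≡ m ℕ.* r) → ∃ λ r → 1 ℕ.≤ r × r ℕ.< m × SumOfFourSquares (+ r * Q)
      conclude (zero , _ , S≡m*0) with sum-of-four-squares≡0 a₁ a₂ a₃ a₄ (trans S≡m*0 (ℕ.*-zeroʳ m))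
      ... | a₁≡0 , a₂≡0 , a₃≡0 , a₄≡0 = contradiction (∣⇒∣ᵤ (zero-residues⇒∣ M Q y₁ y₂ y₃ y₄ t₁ t₂ t₃ t₄
            (ℤ.∣i∣≡0⇒i≡0 a₁≡0) (ℤ.∣i∣≡0⇒i≡0 a₂≡0) (ℤ.∣i∣≡0⇒i≡0 a₃≡0) (ℤ.∣i∣≡0⇒i≡0 a₄≡0) Mq≡))
            (1<m<p⇒m∤p q-prime (s≤s (ℕ.≤-trans 1≤h (ℕ.m≤m+n h h))) m<q)
      conclude (suc r , R≡r , S≡mr) = suc r , s≤s z≤n ,
        ℕ.*-cancelˡ-< m (suc r) m (subst (ℕ._< m ℕ.* m) S≡mr (four-small-squares< ∣y₁∣≤h ∣y₂∣≤h ∣y₃∣≤h ∣y₄∣≤h)) ,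
        subst SumOfFourSquares (ℤ.*-comm Q (+ suc r)) (euler-descent M Q (+ suc r) y₁ y₂ y₃ y₄ t₁ t₂ t₃ t₄ Mq≡
          (trans N≡MR (cong (M *_) R≡r)))

  descent-odd : ∀ {q h} → Prime q → 1 ℕ.≤ h → suc (h ℕ.+ h) ℕ.< q →
    SumOfFourSquares (+ suc (h ℕ.+ h) * + q) →
    ∃ λ r → 1 ℕ.≤ r × r ℕ.< suc (h ℕ.+ h) × SumOfFourSquares (+ r * + q)
  descent-odd {q} {h} q-prime 1≤h m<q (x₁ , x₂ , x₃ , x₄ , mq≡)
    with y₁ , t₁ , refl , ∣y₁∣≤h ← centred-residue h x₁
    with y₂ , t₂ , refl , ∣y₂∣≤h ← centred-residue h x₂
    with y₃ , t₃ , refl , ∣y₃∣≤h ← centred-residue h x₃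
    with y₄ , t₄ , refl , ∣y₄∣≤h ← centred-residue h x₄
    = descent-from-residues q-prime 1≤h m<q y₁ y₂ y₃ y₄ t₁ t₂ t₃ t₄ ∣y₁∣≤h ∣y₂∣≤h ∣y₃∣≤h ∣y₄∣≤h mq≡

  even-or-oddℕ : ∀ m → ∃ λ h → m ≡ h ℕ.+ h ⊎ m ≡ suc (h ℕ.+ h)
  even-or-oddℕ zero = 0 , inj₁ refl
  even-or-oddℕ (suc m) with even-or-oddℕ m
  ... | h , inj₁ refl = h , inj₂ refl
  ... | h , inj₂ refl = suc h , inj₁ (cong suc (sym (ℕ.+-suc h h)))

  descent : ∀ {q m} → Prime q → Acc ℕ._<_ m → 1 ℕ.≤ m → m ℕ.< q →
    SumOfFourSquares (+ m * + q) → SumOfFourSquares (+ q)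
  descent {q} {m} q-prime (acc smaller) 1≤m m<q mq with even-or-oddℕ m
  descent q-prime _ () _ _ | zero , inj₁ refl
  ... | suc h , inj₁ refl = descent q-prime (smaller h<m) (s≤s z≤n) (ℕ.<-trans h<m m<q)
    (sumOfFourSquares-half (subst SumOfFourSquares (trans (cong (_* + q) (ℤ.pos-+ (suc h) (suc h))) (double (+ suc h) (+ q))) mq))
    where
    h<m = ℕ.m<m+n (suc h) (s≤s z≤n)
    double : ∀ H Q → (H + H) * Q ≡ + 2 * (H * Q)
    double = solve-∀
  ... | zero , inj₂ refl = subst SumOfFourSquares (ℤ.*-identityˡ (+ q)) mq
  ... | suc h , inj₂ refl with r , 1≤r , r<m , rq ← descent-odd q-prime (s≤s z≤n) m<q mq
    = descent q-prime (smaller r<m) 1≤r (ℕ.<-trans r<m m<q) rq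

  ∣-small⇒≡0 : ∀ {q} z → + q ∣ z → ℤ.∣ z ∣ ℕ.< q → z ≡ + 0
  ∣-small⇒≡0 z q∣z ∣z∣<q with ℤ.∣ z ∣ in ∣z∣≡ | ∣⇒∣ᵤ q∣z
  ... | zero  | _   = ℤ.∣i∣≡0⇒i≡0 ∣z∣≡
  ... | suc _ | q∣n = contradiction (ℕ.∣⇒≤ q∣n) (ℕ.<⇒≱ ∣z∣<q)

  ∣a²-b²⇒a≡b : ∀ {q h a b} → Prime q → h ℕ.+ h ℕ.< q → a ℕ.≤ h → b ℕ.≤ h →
    + q ∣ + a * + a - + b * + b → a ≡ b
  ∣a²-b²⇒a≡b {q} {h} {a} {b} q-prime 2h<q a≤h b≤h q∣a²-b² =
    [ from-difference , from-sum ] (prime-∣-* q-prime (+ a - + b) (+ a + + b)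
                                      (subst (+ q ∣_) (difference-of-squares (+ a) (+ b)) q∣a²-b²))
    where
    difference-of-squares : ∀ a b → a * a - b * b ≡ (a - b) * (a + b)
    difference-of-squares = solve-∀
    from-difference : + q ∣ + a - + b → a ≡ b
    from-difference q∣a-b = ℤ.+-injective (ℤ.i-j≡0⇒i≡j (+ a) (+ b) (∣-small⇒≡0 (+ a - + b) q∣a-b
      (ℕ.≤-<-trans (ℕ.≤-trans (ℕ.≤-reflexive (cong ℤ.∣_∣ (ℤ.m-n≡m⊖n a b))) (ℤ.∣m⊝n∣≤m⊔n a b))
                   (ℕ.≤-<-trans (ℕ.⊔-lub a≤h b≤h) (ℕ.≤-<-trans (ℕ.m≤m+n h h) 2h<q)))))
    from-sum : + q ∣ + a + + b → a ≡ b
    from-sum q∣a+b = trans (ℕ.m+n≡0⇒m≡0 a a+b≡0) (sym (ℕ.m+n≡0⇒n≡0 a a+b≡0))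
      where
      a+b≡0 : a ℕ.+ b ≡ 0
      a+b≡0 = ℤ.+-injective (trans (ℤ.pos-+ a b) (∣-small⇒≡0 (+ a + + b) q∣a+b
                (subst (ℕ._< q) (cong ℤ.∣_∣ (ℤ.pos-+ a b)) (ℕ.≤-<-trans (ℕ.+-mono-≤ a≤h b≤h) 2h<q))))

  residue : ∀ q .{{_ : ℕ.NonZero q}} → ℤ → Fin q
  residue q z = fromℕ< (ℤ.n%d<d z (+ q))

  residue-≡⇒∣ : ∀ {q} .{{_ : ℕ.NonZero q}} x y → residue q x ≡ residue q y → + q ∣ x - y
  residue-≡⇒∣ {q} x y res≡ = divides (x ℤ./ Q - y ℤ./ Q) (begin
    x - y                                                  ≡⟨ cong₂ _-_ (ℤ.a≡a%n+[a/n]*n x Q) (ℤ.a≡a%n+[a/n]*n y Q) ⟩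
    + (x ℤ.% Q) + x ℤ./ Q * Q - (+ (y ℤ.% Q) + y ℤ./ Q * Q) ≡⟨ cong (λ r → + r + x ℤ./ Q * Q - (+ (y ℤ.% Q) + y ℤ./ Q * Q)) %≡ ⟩
    + (y ℤ.% Q) + x ℤ./ Q * Q - (+ (y ℤ.% Q) + y ℤ./ Q * Q) ≡⟨ cancel (+ (y ℤ.% Q)) (x ℤ./ Q) (y ℤ./ Q) Q ⟩
    (x ℤ./ Q - y ℤ./ Q) * Q                                 ∎)
    where
    open ≡-Reasoning
    Q = + q
    %≡ : x ℤ.% Q ≡ y ℤ.% Q
    %≡ = trans (sym (Fin.toℕ-fromℕ< _)) (trans (cong toℕ res≡) (Fin.toℕ-fromℕ< _))
    cancel : ∀ r k l Q → r + k * Q - (r + l * Q) ≡ (k - l) * Q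
    cancel = solve-∀

  pos-sum-of-two-squares : ∀ x y → + (x ℕ.* x ℕ.+ y ℕ.* y) ≡ + x * + x + + y * + y
  pos-sum-of-two-squares x y = trans (ℤ.pos-+ (x ℕ.* x) (y ℕ.* y)) (cong₂ _+_ (ℤ.pos-* x x) (ℤ.pos-* y y))

  pos-sum-of-two-squares+1 : ∀ x y → + (x ℕ.* x ℕ.+ y ℕ.* y ℕ.+ 1) ≡ + x * + x + + y * + y + + 1
  pos-sum-of-two-squares+1 x y = trans (ℤ.pos-+ (x ℕ.* x ℕ.+ y ℕ.* y) 1) (cong (_+ + 1) (pos-sum-of-two-squares x y))

  -- The q + 1 residues of a² and −1 − b² (a, b ≤ h) must collide, and two squares cannot.
  sum-of-two-squares≡-1-mod : ∀ {h} → Prime (suc (h ℕ.+ h)) →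
    ∃₂ λ x y → x ℕ.≤ h × y ℕ.≤ h × suc (h ℕ.+ h) ℕ.∣ x ℕ.* x ℕ.+ y ℕ.* y ℕ.+ 1
  sum-of-two-squares≡-1-mod {h} q-prime = from-collision (Fin.pigeonhole (s≤s (ℕ.≤-reflexive (sym (ℕ.+-suc h h)))) values)
    where
    q = suc (h ℕ.+ h)
    Goal = ∃₂ λ x y → x ℕ.≤ h × y ℕ.≤ h × q ℕ.∣ x ℕ.* x ℕ.+ y ℕ.* y ℕ.+ 1
    sq : Fin (suc h) → ℤ
    sq a = + toℕ a * + toℕ a
    square -1-square : Fin (suc h) → Fin q
    square a = residue q (sq a)
    -1-square a = residue q (- + 1 - sq a)
    values : Fin (suc h ℕ.+ suc h) → Fin q
    values = [ square , -1-square ] ∘ splitAt (suc h)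
    splitAt-injective : ∀ {i j} → splitAt (suc h) i ≡ splitAt (suc h) j → i ≡ j
    splitAt-injective {i} {j} eq = trans (sym (Fin.join-splitAt (suc h) (suc h) i))
                                    (trans (cong (join (suc h) (suc h)) eq) (Fin.join-splitAt (suc h) (suc h) j))
    ≤h : ∀ (a : Fin (suc h)) → toℕ a ℕ.≤ h
    ≤h a = ℕ.s≤s⁻¹ (Fin.toℕ<n a)
    same-square : ∀ {a b} → + q ∣ sq a - sq b → a ≡ b
    same-square {a} {b} q∣ = Fin.toℕ-injective (∣a²-b²⇒a≡b q-prime ℕ.≤-refl (≤h a) (≤h b) q∣)
    found : ∀ a b → square a ≡ -1-square b → Goal
    found a b eq = toℕ a , toℕ b , ≤h a , ≤h b ,
      subst (q ℕ.∣_) (cong ℤ.∣_∣ (trans (rearrange (sq a) (sq b)) (sym (pos-sum-of-two-squares+1 (toℕ a) (toℕ b)))))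
        (∣⇒∣ᵤ (residue-≡⇒∣ (sq a) (- + 1 - sq b) eq))
      where
      rearrange : ∀ A B → A - (- + 1 - B) ≡ A + B + + 1
      rearrange = solve-∀
    collision : (u v : Fin (suc h) ⊎ Fin (suc h)) → u ≢ v → [ square , -1-square ] u ≡ [ square , -1-square ] v → Goal
    collision (inj₁ a) (inj₁ b) u≢v eq = contradiction (cong inj₁ (same-square (residue-≡⇒∣ (sq a) (sq b) eq))) u≢v
    collision (inj₂ a) (inj₂ b) u≢v eq = contradiction (cong inj₂ (sym (same-square {b} {a}
      (subst (+ q ∣_) (swap (sq a) (sq b)) (residue-≡⇒∣ (- + 1 - sq a) (- + 1 - sq b) eq))))) u≢v
      where
      swap : ∀ A B → - + 1 - A - (- + 1 - B) ≡ B - A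
      swap = solve-∀
    collision (inj₁ a) (inj₂ b) _ eq = found a b eq
    collision (inj₂ a) (inj₁ b) _ eq = found b a (sym eq)
    from-collision : (∃₂ λ i j → i Fin.< j × values i ≡ values j) → Goal
    from-collision (i , j , i<j , eq) = collision (splitAt (suc h) i) (splitAt (suc h) j) (Fin.<⇒≢ i<j ∘ splitAt-injective) eq

  quotient-of-successor-positive : ∀ n k {q} → n ℕ.+ 1 ≡ k ℕ.* q → 1 ℕ.≤ k
  quotient-of-successor-positive n zero n+1≡0 with () ← ℕ.m+n≡0⇒n≡0 n n+1≡0
  quotient-of-successor-positive n (suc k) _ = s≤s z≤n

  sumOfFourSquares-prime : ∀ {q} → Prime q → SumOfFourSquares (+ q)
  sumOfFourSquares-prime {q} q-prime with even-or-oddℕ q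
  ... | h , inj₁ refl with prime⇒irreducible q-prime (ℕ.divides h (trans (cong (h ℕ.+_) (sym (ℕ.+-identityʳ h))) (ℕ.*-comm 2 h)))
  ...   | inj₂ 2≡q = subst (λ n → SumOfFourSquares (+ n)) 2≡q (+ 1 , + 1 , + 0 , + 0 , refl)
  sumOfFourSquares-prime q-prime | zero , inj₂ refl = contradiction q-prime ¬prime[1]
  sumOfFourSquares-prime q-prime | suc h , inj₂ refl
    with x , y , x≤h , y≤h , ℕ.divides k x²+y²+1≡kq ← sum-of-two-squares≡-1-mod q-prime
    = descent q-prime (<-wellFounded k) 1≤k k<q (+ x , + y , + 1 , + 0 , (begin
      + k * + q                          ≡⟨ ℤ.pos-* k q ⟨
      + (k ℕ.* q)                        ≡⟨ cong +_ x²+y²+1≡kq ⟨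
      + (x ℕ.* x ℕ.+ y ℕ.* y ℕ.+ 1)      ≡⟨ pos-sum-of-two-squares+1 x y ⟩
      + x * + x + + y * + y + + 1        ≡⟨ ℤ.+-identityʳ _ ⟨
      + x * + x + + y * + y + + 1 + + 0  ∎))
    where
    open ≡-Reasoning
    q = suc (suc h ℕ.+ suc h)
    1≤k : 1 ℕ.≤ k
    1≤k = quotient-of-successor-positive (x ℕ.* x ℕ.+ y ℕ.* y) k x²+y²+1≡kq
    k<q : k ℕ.< q
    k<q = ℕ.*-cancelʳ-< q k q (subst (ℕ._< q ℕ.* q) (trans (ℕ.+-identityʳ _) x²+y²+1≡kq)
            (four-small-squares< {d = 0} x≤h y≤h (s≤s z≤n) z≤n))

  sumOfFourSquares-productOfPrimes : ∀ {ps} → All Prime ps → SumOfFourSquares (+ product ps)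
  sumOfFourSquares-productOfPrimes []                  = + 1 , + 0 , + 0 , + 0 , refl
  sumOfFourSquares-productOfPrimes {p ∷ ps} (p-prime ∷ ps-prime) =
    subst SumOfFourSquares (sym (ℤ.pos-* p (product ps)))
      (sumOfFourSquares-* (sumOfFourSquares-prime p-prime) (sumOfFourSquares-productOfPrimes ps-prime))

  lagrange-four-squares : ∀ n → SumOfFourSquares (+ n)
  lagrange-four-squares zero = + 0 , + 0 , + 0 , + 0 , refl
  lagrange-four-squares n@(suc _) =
    subst (λ m → SumOfFourSquares (+ m)) (sym isFactorisation) (sumOfFourSquares-productOfPrimes factorsPrime)
    where open PrimeFactorisation (factorise n)

module InvolutionParity {A : Set} (_≟_ : DecidableEquality A) (f : A → A) where

  open import Data.Nat.Divisibility using (_∣_; _∣0; ∣-refl; ∣m∣n⇒∣m+n; ∣m+n∣m⇒∣n; ∣1⇒≡1)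

  infixl 5 _─_
  _─_ : List A → A → List A
  xs ─ a = filter (λ x → ¬? (x ≟ a)) xs

  ∈-─⁺ : ∀ {a x xs} → x ∈ xs → x ≢ a → x ∈ xs ─ a
  ∈-─⁺ = ∈-filter⁺ (λ x → ¬? (x ≟ _))

  ∈-─⁻ : ∀ {a x} xs → x ∈ xs ─ a → x ∈ xs × x ≢ a
  ∈-─⁻ xs = ∈-filter⁻ (λ x → ¬? (x ≟ _)) {xs = xs}

  ─-unique : ∀ {a xs} → Unique xs → Unique (xs ─ a)
  ─-unique = Unique.filter⁺ (λ x → ¬? (x ≟ _))

  length-─ : ∀ {a xs} → Unique xs → a ∈ xs → length xs ≡ suc (length (xs ─ a))
  length-─ {a} {x ∷ xs} (x≢xs ∷ unique) a∈x∷xs with x ≟ a | a∈x∷xs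
  ... | yes refl | _ = cong (suc ∘ length) (sym (filter-all (λ y → ¬? (y ≟ x)) (All.map (λ x≢y y≡x → x≢y (sym y≡x)) x≢xs)))
  ... | no x≢a | here a≡x = contradiction (sym a≡x) x≢a
  ... | no _   | there a∈xs = cong suc (length-─ unique a∈xs)

  ─-idem : ∀ {a} xs → xs ─ a ─ a ≡ xs ─ a
  ─-idem {a} xs = filter-all (λ y → ¬? (y ≟ a)) (All.tabulate (λ y∈ → proj₂ (∈-─⁻ xs y∈)))

  record IsInvolutionOn (xs : List A) : Set where
    field
      closed     : ∀ {x} → x ∈ xs → f x ∈ xs
      involutive : ∀ {x} → x ∈ xs → f (f x) ≡ x

  ─-isInvolutionOn : ∀ {a xs} → IsInvolutionOn xs → a ∈ xs → IsInvolutionOn (xs ─ a ─ f a)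
  ─-isInvolutionOn {a} {xs} inv a∈xs = record
    { closed = λ {y} y∈ys → let (y∈xs─a , y≢fa) = ∈-─⁻ (xs ─ a) y∈ys ; (y∈xs , y≢a) = ∈-─⁻ xs y∈xs─a in
        ∈-─⁺ (∈-─⁺ (closed y∈xs) (λ fy≡a → y≢fa (trans (sym (involutive y∈xs)) (cong f fy≡a))))
              (λ fy≡fa → y≢a (trans (sym (involutive y∈xs)) (trans (cong f fy≡fa) (involutive a∈xs))))
    ; involutive = λ y∈ys → involutive (proj₁ (∈-─⁻ xs (proj₁ (∈-─⁻ (xs ─ a) y∈ys))))
    }
    where open IsInvolutionOn inv

  private
    ∈-──⁻ : ∀ {a b y xs} → y ∈ xs ─ a ─ b → y ∈ xs
    ∈-──⁻ {xs = xs} y∈ = proj₁ (∈-─⁻ xs (proj₁ (∈-─⁻ (xs ─ _) y∈)))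

  fixedPointFree⇒even : ∀ {xs} → Acc ℕ._<_ (length xs) → Unique xs → IsInvolutionOn xs →
    (∀ {x} → x ∈ xs → f x ≢ x) → 2 ∣ length xs
  fixedPointFree⇒even {[]}     _             _      _   _   = 2 ∣0
  fixedPointFree⇒even {x ∷ xs} (acc smaller) unique inv fpf =
    subst (2 ∣_) (sym length≡) (∣m∣n⇒∣m+n ∣-refl
      (fixedPointFree⇒even (smaller (subst (length ys ℕ.<_) (sym length≡) (s≤s (ℕ.n≤1+n _))))
        (─-unique (─-unique unique)) (─-isInvolutionOn inv (here refl)) (fpf ∘ ∈-──⁻)))
    where
    open IsInvolutionOn inv
    ys = (x ∷ xs) ─ x ─ f x
    length≡ : length (x ∷ xs) ≡ suc (suc (length ys))
    length≡ = trans (length-─ unique (here refl))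
                    (cong suc (length-─ (─-unique unique) (∈-─⁺ (closed (here refl)) (fpf (here refl)))))

  uniqueFixedPoint⇒odd : ∀ {a xs} → Unique xs → IsInvolutionOn xs → a ∈ xs → f a ≡ a →
    (∀ {x} → x ∈ xs → f x ≡ x → x ≡ a) → ¬ 2 ∣ length xs
  uniqueFixedPoint⇒odd {a} {xs} unique inv a∈xs fa≡a fixed⇒≡a 2∣xs =
    contradiction (subst (2 ∣_) (length-─ unique a∈xs) 2∣xs) (even⇒¬even-suc 2∣rest)
    where
    2∣rest : 2 ∣ length (xs ─ a)
    2∣rest = subst (2 ∣_) (cong length (─-idem xs))
      (fixedPointFree⇒even (<-wellFounded _) (─-unique (─-unique unique))
        (subst (λ b → IsInvolutionOn (xs ─ a ─ b)) fa≡a (─-isInvolutionOn inv a∈xs))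
        (λ y∈ fy≡y → proj₂ (∈-─⁻ xs (proj₁ (∈-─⁻ (xs ─ a) y∈))) (fixed⇒≡a (∈-──⁻ y∈) fy≡y)))
    even⇒¬even-suc : ∀ {n} → 2 ∣ n → ¬ 2 ∣ suc n
    even⇒¬even-suc {n} 2∣n 2∣1+n with () ← ∣1⇒≡1 (∣m+n∣m⇒∣n (subst (2 ∣_) (ℕ.+-comm 1 n) 2∣1+n) 2∣n)

module Windmill {p k : ℕ} (p-prime : Prime p) (p≡4k+1 : p ≡ suc (4 ℕ.* k)) where

  open import Data.Nat.Base using (_+_; _*_; _∸_; _≤_; _<_)
  open import Data.Nat.Properties using (_<?_)
  open import Data.Nat.Divisibility using (_∣_; divides; ∣m+n∣m⇒∣n; ∣1⇒≡1)
  open PrimeDivisibility using (prime-factor≡1)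

  Triple : Set
  Triple = ℕ × ℕ × ℕ

  Solution : Triple → Set
  Solution (x , y , z) = x * x + 4 * (y * z) ≡ p

  p≢1 : p ≢ 1
  p≢1 refl = ¬prime[1] p-prime

  2∣4* : ∀ n → 2 ∣ 4 * n
  2∣4* n = divides (2 * n) (4n≡2n*2 n)
    where
    4n≡2n*2 : ∀ n → 4 * n ≡ 2 * n * 2
    4n≡2n*2 = ℕ.solve-∀

  p-odd : ¬ 2 ∣ p
  p-odd 2∣p with () ← ∣1⇒≡1 (∣m+n∣m⇒∣n (subst (2 ∣_) (trans p≡4k+1 (ℕ.+-comm 1 (4 * k))) 2∣p) (2∣4* k))

  p-not-square : ∀ x → x * x ≢ p
  p-not-square x x²≡p with prime-factor≡1 {m = x} p-prime x²≡p
  ... | inj₁ refl = p≢1 (sym x²≡p)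
  ... | inj₂ refl = p≢1 (sym x²≡p)

  solution-positive : ∀ {x y z} → Solution (x , y , z) → 1 ≤ x × 1 ≤ y × 1 ≤ z
  solution-positive {zero} {y} {z} 4yz≡p = contradiction (subst (2 ∣_) 4yz≡p (2∣4* (y * z))) p-odd
  solution-positive {suc x} {zero} x²≡p = contradiction (trans (sym (ℕ.+-identityʳ _)) x²≡p) (p-not-square (suc x))
  solution-positive {suc x} {suc y} {zero} x²≡p =
    contradiction (trans (sym (trans (cong (λ n → suc x * suc x + 4 * n) (ℕ.*-zeroʳ (suc y))) (ℕ.+-identityʳ _))) x²≡p)
                  (p-not-square (suc x))
  solution-positive {suc x} {suc y} {suc z} _ = s≤s z≤n , s≤s z≤n , s≤s z≤n

  zagier : Triple → Triple
  zagier (x , y , z) with x + z <? y | x <? 2 * y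
  ... | yes _ | _     = x + 2 * z , z , y ∸ (x + z)
  ... | no _  | yes _ = 2 * y ∸ x , y , x + z ∸ y
  ... | no _  | no _  = x ∸ 2 * y , x ∸ 2 * y + y + z , y

  zagier-left : ∀ {x y z} → x + z < y → zagier (x , y , z) ≡ (x + 2 * z , z , y ∸ (x + z))
  zagier-left {x} {y} {z} x+z<y with x + z <? y
  ... | yes _     = refl
  ... | no x+z≮y = contradiction x+z<y x+z≮y

  zagier-middle : ∀ {x y z} → y ≤ x + z → x < 2 * y → zagier (x , y , z) ≡ (2 * y ∸ x , y , x + z ∸ y)
  zagier-middle {x} {y} {z} y≤x+z x<2y with x + z <? y | x <? 2 * y
  ... | yes x+z<y | _       = contradiction y≤x+z (ℕ.<⇒≱ x+z<y)
  ... | no _      | yes _   = refl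
  ... | no _      | no x≮2y = contradiction x<2y x≮2y

  zagier-right : ∀ {x y z} → 2 * y ≤ x → zagier (x , y , z) ≡ (x ∸ 2 * y , x ∸ 2 * y + y + z , y)
  zagier-right {x} {y} {z} 2y≤x with x + z <? y | x <? 2 * y
  ... | yes x+z<y | _       = contradiction (ℕ.≤-trans (ℕ.m≤m+n y (y + 0)) (ℕ.≤-trans 2y≤x (ℕ.m≤m+n x z))) (ℕ.<⇒≱ x+z<y)
  ... | no _      | yes x<2y = contradiction 2y≤x (ℕ.<⇒≱ x<2y)
  ... | no _      | no _     = refl

  zagier-cases : ∀ x y z → x + z < y ⊎ (y ≤ x + z × x < 2 * y) ⊎ 2 * y ≤ x
  zagier-cases x y z with x + z <? y | x <? 2 * y
  ... | yes x+z<y | _         = inj₁ x+z<y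
  ... | no x+z≮y  | yes x<2y  = inj₂ (inj₁ (ℕ.≮⇒≥ x+z≮y , x<2y))
  ... | no _      | no x≮2y   = inj₂ (inj₂ (ℕ.≮⇒≥ x≮2y))

  middle-square-identity : ∀ {x y z a b} → x + a ≡ 2 * y → y + b ≡ x + z →
    a * a + 4 * (y * b) ≡ x * x + 4 * (y * z)
  middle-square-identity {x} {y} {z} {a} {b} x+a≡2y y+b≡x+z = ℕ.+-cancelʳ-≡ (4 * (y * y)) _ _ (begin
    a * a + 4 * (y * b) + 4 * (y * y)             ≡⟨ collect a b y ⟩
    a * a + 4 * (y * (y + b))                     ≡⟨ cong (λ w → a * a + 4 * (y * w)) y+b≡x+z ⟩
    a * a + 4 * (y * (x + z))                     ≡⟨ split a x y z ⟩
    a * a + 2 * x * (2 * y) + 4 * (y * z)         ≡⟨ cong (λ w → a * a + 2 * x * w + 4 * (y * z)) x+a≡2y ⟨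
    a * a + 2 * x * (x + a) + 4 * (y * z)         ≡⟨ complete-square a x y z ⟩
    (x + a) * (x + a) + x * x + 4 * (y * z)       ≡⟨ cong (λ w → w * w + x * x + 4 * (y * z)) x+a≡2y ⟩
    2 * y * (2 * y) + x * x + 4 * (y * z)         ≡⟨ rearrange x y z ⟩
    x * x + 4 * (y * z) + 4 * (y * y)             ∎)
    where
    open ≡-Reasoning
    collect : ∀ a b y → a * a + 4 * (y * b) + 4 * (y * y) ≡ a * a + 4 * (y * (y + b))
    collect = ℕ.solve-∀
    split : ∀ a x y z → a * a + 4 * (y * (x + z)) ≡ a * a + 2 * x * (2 * y) + 4 * (y * z)
    split = ℕ.solve-∀
    complete-square : ∀ a x y z → a * a + 2 * x * (x + a) + 4 * (y * z) ≡ (x + a) * (x + a) + x * x + 4 * (y * z)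
    complete-square = ℕ.solve-∀
    rearrange : ∀ x y z → 2 * y * (2 * y) + x * x + 4 * (y * z) ≡ x * x + 4 * (y * z) + 4 * (y * y)
    rearrange = ℕ.solve-∀

  zagier-solution : ∀ t → Solution t → Solution (zagier t)
  zagier-solution (x , y , z) sol with zagier-cases x y z
  ... | inj₁ x+z<y = subst Solution (sym (zagier-left {x} {y} {z} x+z<y)) (begin
    (x + 2 * z) * (x + 2 * z) + 4 * (z * d)  ≡⟨ expand x z d ⟩
    x * x + 4 * ((x + z + d) * z)            ≡⟨ cong (λ w → x * x + 4 * (w * z)) (ℕ.m+[n∸m]≡n (ℕ.<⇒≤ x+z<y)) ⟩
    x * x + 4 * (y * z)                      ≡⟨ sol ⟩
    p                                        ∎)
    where
    open ≡-Reasoning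
    d = y ∸ (x + z)
    expand : ∀ x z d → (x + 2 * z) * (x + 2 * z) + 4 * (z * d) ≡ x * x + 4 * ((x + z + d) * z)
    expand = ℕ.solve-∀
  ... | inj₂ (inj₁ (y≤x+z , x<2y)) = subst Solution (sym (zagier-middle {x} {y} {z} y≤x+z x<2y))
    (trans (middle-square-identity {x} {y} {z} (ℕ.m+[n∸m]≡n (ℕ.<⇒≤ x<2y)) (ℕ.m+[n∸m]≡n y≤x+z)) sol)
  ... | inj₂ (inj₂ 2y≤x) = subst Solution (sym (zagier-right {x} {y} {z} 2y≤x)) (begin
    c * c + 4 * ((c + y + z) * y)            ≡⟨ expand c y z ⟩
    (c + 2 * y) * (c + 2 * y) + 4 * (y * z)  ≡⟨ cong (λ w → w * w + 4 * (y * z)) (ℕ.m∸n+n≡m 2y≤x) ⟩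
    x * x + 4 * (y * z)                      ≡⟨ sol ⟩
    p                                        ∎)
    where
    open ≡-Reasoning
    c = x ∸ 2 * y
    expand : ∀ c y z → c * c + 4 * ((c + y + z) * y) ≡ (c + 2 * y) * (c + 2 * y) + 4 * (y * z)
    expand = ℕ.solve-∀

  zagier-involutive-left : ∀ {x y z} → x + z < y → zagier (zagier (x , y , z)) ≡ (x , y , z)
  zagier-involutive-left {x} {y} {z} x+z<y = begin
    zagier (zagier (x , y , z))             ≡⟨ cong zagier (zagier-left {x} {y} {z} x+z<y) ⟩
    zagier (x + 2 * z , z , d)              ≡⟨ zagier-right {x + 2 * z} {z} {d} (ℕ.m≤n+m (2 * z) x) ⟩
    (x + 2 * z ∸ 2 * z , x + 2 * z ∸ 2 * z + z + d , z)
                                            ≡⟨ cong (λ c → c , c + z + d , z) (ℕ.m+n∸n≡m x (2 * z)) ⟩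
    (x , x + z + d , z)                     ≡⟨ cong (λ w → x , w , z) (ℕ.m+[n∸m]≡n (ℕ.<⇒≤ x+z<y)) ⟩
    (x , y , z)                             ∎
    where
    open ≡-Reasoning
    d = y ∸ (x + z)

  zagier-involutive-middle : ∀ {x y z} → 1 ≤ x → y ≤ x + z → x < 2 * y → zagier (zagier (x , y , z)) ≡ (x , y , z)
  zagier-involutive-middle {x} {y} {z} 1≤x y≤x+z x<2y = begin
    zagier (zagier (x , y , z))             ≡⟨ cong zagier (zagier-middle {x} {y} {z} y≤x+z x<2y) ⟩
    zagier (a , y , b)                      ≡⟨ zagier-middle {a} {y} {b} (subst (y ≤_) (sym a+b≡y+z) (ℕ.m≤m+n y z))
                                                 (subst (a <_) x+a≡2y (ℕ.m<n+m a 1≤x)) ⟩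
    (2 * y ∸ a , y , a + b ∸ y)             ≡⟨ cong₂ (λ u w → u , y , w) (trans (cong (_∸ a) (sym x+a≡2y)) (ℕ.m+n∸n≡m x a))
                                                                          (trans (cong (_∸ y) a+b≡y+z) (ℕ.m+n∸m≡n y z)) ⟩
    (x , y , z)                             ∎
    where
    open ≡-Reasoning
    a = 2 * y ∸ x
    b = x + z ∸ y
    x+a≡2y : x + a ≡ 2 * y
    x+a≡2y = ℕ.m+[n∸m]≡n (ℕ.<⇒≤ x<2y)
    interchange : ∀ x y a b → x + y + (a + b) ≡ (x + a) + (y + b)
    interchange = ℕ.solve-∀
    regroup : ∀ x y z → 2 * y + (x + z) ≡ x + y + (y + z)
    regroup = ℕ.solve-∀
    a+b≡y+z : a + b ≡ y + z
    a+b≡y+z = ℕ.+-cancelˡ-≡ (x + y) _ _ (begin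
      x + y + (a + b)        ≡⟨ interchange x y a b ⟩
      (x + a) + (y + b)      ≡⟨ cong₂ _+_ x+a≡2y (ℕ.m+[n∸m]≡n y≤x+z) ⟩
      2 * y + (x + z)        ≡⟨ regroup x y z ⟩
      x + y + (y + z)        ∎)

  zagier-involutive-right : ∀ {x y z} → 1 ≤ z → 2 * y ≤ x → zagier (zagier (x , y , z)) ≡ (x , y , z)
  zagier-involutive-right {x} {y} {z} 1≤z 2y≤x = begin
    zagier (zagier (x , y , z))             ≡⟨ cong zagier (zagier-right {x} {y} {z} 2y≤x) ⟩
    zagier (c , c + y + z , y)              ≡⟨ zagier-left {c} {c + y + z} {y} (ℕ.m<m+n (c + y) 1≤z) ⟩
    (c + 2 * y , y , c + y + z ∸ (c + y))   ≡⟨ cong₂ (λ u w → u , y , w) (ℕ.m∸n+n≡m 2y≤x) (ℕ.m+n∸m≡n (c + y) z) ⟩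
    (x , y , z)                             ∎
    where
    open ≡-Reasoning
    c = x ∸ 2 * y

  zagier-involutive : ∀ t → Solution t → zagier (zagier t) ≡ t
  zagier-involutive (x , y , z) sol with solution-positive {x} {y} {z} sol | zagier-cases x y z
  ... | _         , _ , _   | inj₁ x+z<y                 = zagier-involutive-left x+z<y
  ... | 1≤x       , _ , _   | inj₂ (inj₁ (y≤x+z , x<2y)) = zagier-involutive-middle 1≤x y≤x+z x<2y
  ... | _         , _ , 1≤z | inj₂ (inj₂ 2y≤x)           = zagier-involutive-right 1≤z 2y≤x

  middle-fixedPoint : ∀ {x y z} → Solution (x , y , z) → 1 ≤ z → x ≡ y → (x , y , z) ≡ (1 , 1 , k)
  middle-fixedPoint {x} {_} {z} sol 1≤z refl with prime-factor≡1 {m = x} p-prime (trans (factor x z) sol)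
    where
    factor : ∀ x z → x * (x + 4 * z) ≡ x * x + 4 * (x * z)
    factor = ℕ.solve-∀
  ... | inj₁ refl = cong (λ z → 1 , 1 , z) (ℕ.*-cancelˡ-≡ z k 4 (ℕ.suc-injective (trans 1+4z≡p p≡4k+1)))
    where
    1+4z≡p : suc (4 * z) ≡ p
    1+4z≡p = trans (cong (λ w → suc (4 * w)) (sym (ℕ.+-identityʳ z))) sol
  ... | inj₂ x+4z≡1 = contradiction (subst (4 ≤_) x+4z≡1 (ℕ.≤-trans (ℕ.*-monoʳ-≤ 4 1≤z) (ℕ.m≤n+m (4 * z) x))) λ { (s≤s ()) }

  zagier-fixedPoint : ∀ t → Solution t → zagier t ≡ t → t ≡ (1 , 1 , k)
  zagier-fixedPoint (x , y , z) sol ζt≡t with solution-positive {x} {y} {z} sol | zagier-cases x y z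
  ... | _ , _ , 1≤z | inj₁ x+z<y =
    contradiction (cong proj₁ (trans (sym (zagier-left {x} {y} {z} x+z<y)) ζt≡t))
                  (ℕ.<⇒≢ (ℕ.m<m+n x (ℕ.≤-trans 1≤z (ℕ.m≤m+n z (z + 0)))) ∘ sym)
  ... | _ , _ , 1≤z | inj₂ (inj₂ 2y≤x) =
    contradiction (cong (proj₁ ∘ proj₂) (trans (sym (zagier-right {x} {y} {z} 2y≤x)) ζt≡t))
                  (ℕ.<⇒≢ (ℕ.<-≤-trans (ℕ.m<m+n y 1≤z) (ℕ.+-monoˡ-≤ z (ℕ.m≤n+m y (x ∸ 2 * y)))) ∘ sym)
  ... | _ , _ , 1≤z | inj₂ (inj₁ (y≤x+z , x<2y)) = middle-fixedPoint sol 1≤z (ℕ.*-cancelˡ-≡ x y 2 (begin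
    2 * x              ≡⟨ cong (x +_) (ℕ.+-identityʳ x) ⟩
    x + x              ≡⟨ cong (x +_) (cong proj₁ (trans (sym (zagier-middle {x} {y} {z} y≤x+z x<2y)) ζt≡t)) ⟨
    x + (2 * y ∸ x)    ≡⟨ ℕ.m+[n∸m]≡n (ℕ.<⇒≤ x<2y) ⟩
    2 * y              ∎))
    where open ≡-Reasoning

  swap : Triple → Triple
  swap (x , y , z) = x , z , y

  swap-solution : ∀ t → Solution t → Solution (swap t)
  swap-solution (x , y , z) sol = trans (cong (λ w → x * x + 4 * w) (ℕ.*-comm z y)) sol

  _≟ₜ_ : DecidableEquality Triple
  _≟ₜ_ = ≡-dec ℕ._≟_ (≡-dec ℕ._≟_ ℕ._≟_)

  solution? : Decidable Solution
  solution? (x , y , z) = x * x + 4 * (y * z) ℕ.≟ p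

  boundedTriples : List Triple
  boundedTriples = cartesianProduct (upTo (suc p)) (cartesianProduct (upTo (suc p)) (upTo (suc p)))

  solutions : List Triple
  solutions = filter solution? boundedTriples

  solutions-unique : Unique solutions
  solutions-unique = Unique.filter⁺ solution?
    (Unique.cartesianProduct⁺ (Unique.upTo⁺ (suc p)) (Unique.cartesianProduct⁺ (Unique.upTo⁺ (suc p)) (Unique.upTo⁺ (suc p))))

  ∈-solutions⁻ : ∀ {t} → t ∈ solutions → Solution t
  ∈-solutions⁻ t∈ = proj₂ (∈-filter⁻ solution? {xs = boundedTriples} t∈)

  ∈-solutions⁺ : ∀ {t} → Solution t → t ∈ solutions
  ∈-solutions⁺ {x , y , z} sol with solution-positive {x} {y} {z} sol
  ... | 1≤x , 1≤y , 1≤z = ∈-filter⁺ solution? {xs = boundedTriples} bounded sol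
    where
    4yz≤p : 4 * (y * z) ≤ p
    4yz≤p = subst (4 * (y * z) ≤_) sol (ℕ.m≤n+m _ (x * x))
    x≤p : x ≤ p
    x≤p = ℕ.≤-trans (ℕ.m≤m*n x x {{ℕ.>-nonZero 1≤x}}) (subst (x * x ≤_) sol (ℕ.m≤m+n _ _))
    y≤p : y ≤ p
    y≤p = ℕ.≤-trans (ℕ.m≤m*n y z {{ℕ.>-nonZero 1≤z}}) (ℕ.≤-trans (ℕ.m≤n*m (y * z) 4) 4yz≤p)
    z≤p : z ≤ p
    z≤p = ℕ.≤-trans (ℕ.m≤n*m z y {{ℕ.>-nonZero 1≤y}}) (ℕ.≤-trans (ℕ.m≤n*m (y * z) 4) 4yz≤p)
    bounded : (x , y , z) ∈ boundedTriples
    bounded = ∈-cartesianProduct⁺ (∈-upTo⁺ (s≤s x≤p)) (∈-cartesianProduct⁺ (∈-upTo⁺ (s≤s y≤p)) (∈-upTo⁺ (s≤s z≤p)))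

  module Swap   = InvolutionParity _≟ₜ_ swap
  module Zagier = InvolutionParity _≟ₜ_ zagier

  swap-involution : Swap.IsInvolutionOn solutions
  swap-involution = record
    { closed     = λ {t} t∈ → ∈-solutions⁺ (swap-solution t (∈-solutions⁻ t∈))
    ; involutive = λ _ → refl
    }

  zagier-involution : Zagier.IsInvolutionOn solutions
  zagier-involution = record
    { closed     = λ {t} t∈ → ∈-solutions⁺ (zagier-solution t (∈-solutions⁻ t∈))
    ; involutive = λ {t} t∈ → zagier-involutive t (∈-solutions⁻ t∈)
    }

  fermat-two-squares : ∃₂ λ a b → p ≡ a * a + b * b
  fermat-two-squares with any? (λ t → swap t ≟ₜ t) solutions
  ... | yes fixed with (x , y , z) , t∈ , swap-t≡t ← find fixed =
    x , 2 * y , sym (trans (sym (square-of-double x y)) (subst (λ w → Solution (x , y , w)) (cong (proj₁ ∘ proj₂) swap-t≡t) (∈-solutions⁻ t∈)))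
    where
    square-of-double : ∀ x y → x * x + 4 * (y * y) ≡ x * x + 2 * y * (2 * y)
    square-of-double = ℕ.solve-∀
  ... | no no-fixed = contradiction
    (Swap.fixedPointFree⇒even (<-wellFounded _) solutions-unique swap-involution
      (λ t∈ swap-t≡t → no-fixed (Any.map (λ { refl → swap-t≡t }) t∈)))
    (Zagier.uniqueFixedPoint⇒odd solutions-unique zagier-involution
      (∈-solutions⁺ (trans (cong (λ w → suc (4 * w)) (ℕ.+-identityʳ k)) (sym p≡4k+1)))
      (zagier-middle {1} {1} {k} (s≤s z≤n) (s≤s (s≤s z≤n)))
      (λ {t} t∈ ζt≡t → zagier-fixedPoint t (∈-solutions⁻ t∈) ζt≡t))

module MultiplesOfPrime {p : ℕ} (p-prime : Prime p) (p≢2 : p ≢ 2)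
                        {a b : ℤ.ℤ} (p≡a²+b² : ℤ.+ p ≡ a ℤ.* a ℤ.+ b ℤ.* b) where

  open import Data.Integer.Base using (ℤ; +_; _+_; _*_; _-_)
  open import Data.Integer.Divisibility.Signed
    using (_∣_; divides; _∣?_; ∣⇒∣ᵤ; ∣m∣n⇒∣m+n; ∣m∣n⇒∣m-n; ∣n⇒∣m*n; ∣m⇒∣m*n)
  open import Data.Integer.Tactic.RingSolver using (solve-∀)
  open PrimeDivisibility
  open FourSquares using (lagrange-four-squares)

  P : ℤ
  P = + p

  P∤2 : ¬ P ∣ + 2
  P∤2 P∣2 with prime⇒irreducible prime[2] (∣⇒∣ᵤ P∣2)
  ... | inj₁ p≡1 = ¬prime[1] (subst Prime p≡1 p-prime)
  ... | inj₂ p≡2 = p≢2 p≡2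

  ∣s∣+∣t∣<∣sP∣+∣tP∣ : ∀ s t → ¬ (s ≡ + 0 × t ≡ + 0) → ℤ.∣ s ∣ ℕ.+ ℤ.∣ t ∣ ℕ.< ℤ.∣ s * P ∣ ℕ.+ ℤ.∣ t * P ∣
  ∣s∣+∣t∣<∣sP∣+∣tP∣ s t st≢0 with ℤ.∣ s ∣ ℕ.+ ℤ.∣ t ∣ in ∣s∣+∣t∣≡
  ... | zero = contradiction (ℤ.∣i∣≡0⇒i≡0 (ℕ.m+n≡0⇒m≡0 _ ∣s∣+∣t∣≡) , ℤ.∣i∣≡0⇒i≡0 (ℕ.m+n≡0⇒n≡0 _ ∣s∣+∣t∣≡)) st≢0
  ... | suc n = subst (suc n ℕ.<_) (begin
    suc n ℕ.* p                          ≡⟨ cong (ℕ._* p) ∣s∣+∣t∣≡ ⟨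
    (ℤ.∣ s ∣ ℕ.+ ℤ.∣ t ∣) ℕ.* p          ≡⟨ ℕ.*-distribʳ-+ p ℤ.∣ s ∣ ℤ.∣ t ∣ ⟩
    ℤ.∣ s ∣ ℕ.* p ℕ.+ ℤ.∣ t ∣ ℕ.* p      ≡⟨ cong₂ ℕ._+_ (ℤ.abs-* s P) (ℤ.abs-* t P) ⟨
    ℤ.∣ s * P ∣ ℕ.+ ℤ.∣ t * P ∣          ∎) (ℕ.m<m*n (suc n) p (ℕ.nonTrivial⇒n>1 p {{prime⇒nonTrivial p-prime}}))
    where open ≡-Reasoning

  ¬both-zero-*P⁻¹ : ∀ {s t} → ¬ (s * P ≡ + 0 × t * P ≡ + 0) → ¬ (s ≡ + 0 × t ≡ + 0)
  ¬both-zero-*P⁻¹ sP,tP≢0 (refl , refl) = sP,tP≢0 (refl , refl)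

  SumOfTwoSquaresNotDivBy : ℤ → Set
  SumOfTwoSquaresNotDivBy n = ∃₂ λ u v → n ≡ u * u + v * v × ¬ P ∣ u × ¬ P ∣ v

  brahmagupta-notDivBy : ∀ {c d} → P ∣ c * c + d * d → ¬ P ∣ c → ¬ P ∣ d → ∀ s t → ¬ (P ∣ s × P ∣ t) →
    SumOfTwoSquaresNotDivBy ((c * c + d * d) * (s * s + t * t))
  brahmagupta-notDivBy {c} {d} P∣c²+d² P∤c P∤d s t ¬P∣s,t with P ∣? c * s - d * t | P ∣? c * s + d * t
  ... | no P∤u | _ = c * s - d * t , c * t + d * s , identity₋ c d s t , P∤u ,
    λ P∣v → P∤u (prime-∣-*-cancelˡ p-prime P∤c (subst (P ∣_) (sym (expand₋ c d s t))
                   (∣m∣n⇒∣m-n (∣m⇒∣m*n s P∣c²+d²) (∣n⇒∣m*n d P∣v))))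
    where
    expand₋ : ∀ c d s t → c * (c * s - d * t) ≡ (c * c + d * d) * s - d * (c * t + d * s)
    expand₋ = solve-∀
    identity₋ : ∀ c d s t → (c * c + d * d) * (s * s + t * t) ≡ (c * s - d * t) * (c * s - d * t) + (c * t + d * s) * (c * t + d * s)
    identity₋ = solve-∀
  ... | yes _ | no P∤u = c * s + d * t , c * t - d * s , identity₊ c d s t , P∤u ,
    λ P∣v → P∤u (prime-∣-*-cancelˡ p-prime P∤c (subst (P ∣_) (sym (expand₊ c d s t))
                   (∣m∣n⇒∣m+n (∣m⇒∣m*n s P∣c²+d²) (∣n⇒∣m*n d P∣v))))
    where
    identity₊ : ∀ c d s t → (c * c + d * d) * (s * s + t * t) ≡ (c * s + d * t) * (c * s + d * t) + (c * t - d * s) * (c * t - d * s)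
    identity₊ = solve-∀
    expand₊ : ∀ c d s t → c * (c * s + d * t) ≡ (c * c + d * d) * s + d * (c * t - d * s)
    expand₊ = solve-∀
  ... | yes P∣u₋ | yes P∣u₊ = contradiction
    ( prime-∣-*-cancelˡ p-prime {c} {s} P∤c (prime-∣-*-cancelˡ p-prime {+ 2} {c * s} P∤2 (subst (P ∣_) (sum c d s t) (∣m∣n⇒∣m+n P∣u₋ P∣u₊)))
    , prime-∣-*-cancelˡ p-prime {d} {t} P∤d (prime-∣-*-cancelˡ p-prime {+ 2} {d * t} P∤2 (subst (P ∣_) (difference c d s t) (∣m∣n⇒∣m-n P∣u₊ P∣u₋))))
    ¬P∣s,t
    where
    sum : ∀ c d s t → c * s - d * t + (c * s + d * t) ≡ + 2 * (c * s)
    sum = solve-∀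
    difference : ∀ c d s t → c * s + d * t - (c * s - d * t) ≡ + 2 * (d * t)
    difference = solve-∀

  P∤a : ¬ P ∣ a
  P∤a = prime-sum-of-two-squares⇒∤ p-prime {a} {b} p≡a²+b²

  P∤b : ¬ P ∣ b
  P∤b = prime-sum-of-two-squares⇒∤ p-prime {b} {a} (trans p≡a²+b² (ℤ.+-comm (a * a) (b * b)))

  P∣a²+b² : P ∣ a * a + b * b
  P∣a²+b² = subst (P ∣_) p≡a²+b² (divides (+ 1) (sym (ℤ.*-identityˡ P)))

  c₀ d₀ : ℤ
  c₀ = a * a - b * b
  d₀ = + 2 * (a * b)

  c₀²+d₀²≡P² : c₀ * c₀ + d₀ * d₀ ≡ P * P
  c₀²+d₀²≡P² = trans (square-of-sum a b) (cong (λ n → n * n) (sym p≡a²+b²))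
    where
    square-of-sum : ∀ a b → (a * a - b * b) * (a * a - b * b) + (+ 2 * (a * b)) * (+ 2 * (a * b)) ≡ (a * a + b * b) * (a * a + b * b)
    square-of-sum = solve-∀

  P∤c₀ : ¬ P ∣ c₀
  P∤c₀ P∣c₀ = prime-∤-* p-prime P∤2 (prime-∤-* p-prime P∤a P∤a)
    (subst (P ∣_) (double-square a b) (∣m∣n⇒∣m+n P∣c₀ P∣a²+b²))
    where
    double-square : ∀ a b → a * a - b * b + (a * a + b * b) ≡ + 2 * (a * a)
    double-square = solve-∀

  P∤d₀ : ¬ P ∣ d₀
  P∤d₀ = prime-∤-* p-prime P∤2 (prime-∤-* p-prime P∤a P∤b)

  P∣c₀²+d₀² : P ∣ c₀ * c₀ + d₀ * d₀
  P∣c₀²+d₀² = subst (P ∣_) (sym c₀²+d₀²≡P²) (∣m⇒∣m*n P (divides (+ 1) (sym (ℤ.*-identityˡ P))))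

  p-times-sum-of-two-squares : ∀ s t → Acc ℕ._<_ (ℤ.∣ s ∣ ℕ.+ ℤ.∣ t ∣) → ¬ (s ≡ + 0 × t ≡ + 0) →
    SumOfTwoSquaresNotDivBy (P * (s * s + t * t))
  p-times-sum-of-two-squares s t (acc smaller) st≢0 with P ∣? s | P ∣? t
  ... | no P∤s | _ = subst (λ n → SumOfTwoSquaresNotDivBy (n * (s * s + t * t))) (sym p≡a²+b²)
                           (brahmagupta-notDivBy P∣a²+b² P∤a P∤b s t (P∤s ∘ proj₁))
  ... | yes _ | no P∤t = subst (λ n → SumOfTwoSquaresNotDivBy (n * (s * s + t * t))) (sym p≡a²+b²)
                           (brahmagupta-notDivBy P∣a²+b² P∤a P∤b s t (P∤t ∘ proj₂))
  ... | yes (divides s′ refl) | yes (divides t′ refl)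
    with u , v , p[s′²+t′²]≡ , P∤u , _ ← p-times-sum-of-two-squares s′ t′
           (smaller (∣s∣+∣t∣<∣sP∣+∣tP∣ s′ t′ (¬both-zero-*P⁻¹ st≢0))) (¬both-zero-*P⁻¹ st≢0)
    = subst SumOfTwoSquaresNotDivBy (begin
      (c₀ * c₀ + d₀ * d₀) * (u * u + v * v)   ≡⟨ cong₂ _*_ c₀²+d₀²≡P² (sym p[s′²+t′²]≡) ⟩
      P * P * (P * (s′ * s′ + t′ * t′))        ≡⟨ rescale P s′ t′ ⟩
      P * (s′ * P * (s′ * P) + t′ * P * (t′ * P)) ∎)
      (brahmagupta-notDivBy P∣c₀²+d₀² P∤c₀ P∤d₀ u v (P∤u ∘ proj₁))
    where
    open ≡-Reasoning
    rescale : ∀ P s t → P * P * (P * (s * s + t * t)) ≡ P * (s * P * (s * P) + t * P * (t * P))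
    rescale = solve-∀

  pair-zero-or-p-times : ∀ s t → (s ≡ + 0 × t ≡ + 0) ⊎ SumOfTwoSquaresNotDivBy (P * (s * s + t * t))
  pair-zero-or-p-times s t with s ℤ.≟ + 0 | t ℤ.≟ + 0
  ... | yes refl | yes refl = inj₁ (refl , refl)
  ... | no s≢0   | _        = inj₂ (p-times-sum-of-two-squares s t (<-wellFounded _) (s≢0 ∘ proj₁))
  ... | yes _    | no t≢0   = inj₂ (p-times-sum-of-two-squares s t (<-wellFounded _) (t≢0 ∘ proj₂))

  sumOfSquaresNotDivBy₂ : ∀ {n} → SumOfTwoSquaresNotDivBy n → SumOfSquaresNotDivBy p 2 n
  sumOfSquaresNotDivBy₂ (u , v , n≡ , P∤u , P∤v) =
    sumOfSquaresNotDivBy p-prime (λ { zero → u ; (suc zero) → v }) (trans n≡ (pad u v))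
      (λ { zero → P∤u ; (suc zero) → P∤v })
    where
    pad : ∀ u v → u * u + v * v ≡ u * u + (v * v + + 0)
    pad = solve-∀

  sumOfSquaresNotDivBy₄ : ∀ {m n} → SumOfTwoSquaresNotDivBy m → SumOfTwoSquaresNotDivBy n → SumOfSquaresNotDivBy p 4 (m + n)
  sumOfSquaresNotDivBy₄ (u₁ , v₁ , m≡ , P∤u₁ , P∤v₁) (u₂ , v₂ , n≡ , P∤u₂ , P∤v₂) =
    sumOfSquaresNotDivBy p-prime (λ { zero → u₁ ; (suc zero) → v₁ ; (suc (suc zero)) → u₂ ; (suc (suc (suc zero))) → v₂ })
      (trans (cong₂ _+_ m≡ n≡) (regroup u₁ v₁ u₂ v₂))
      (λ { zero → P∤u₁ ; (suc zero) → P∤v₁ ; (suc (suc zero)) → P∤u₂ ; (suc (suc (suc zero))) → P∤v₂ })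
    where
    regroup : ∀ a b c d → a * a + b * b + (c * c + d * d) ≡ a * a + (b * b + (c * c + (d * d + + 0)))
    regroup = solve-∀

  positive-multiple⇒sumOfSquaresNotDivBy : ∀ {n} → 1 ℕ.≤ n → p ℕ.∣ n → ∃ λ k → 1 ℕ.≤ k × k ℕ.≤ 4 × SumOfSquaresNotDivBy p k (+ n)
  positive-multiple⇒sumOfSquaresNotDivBy {n} 1≤n (ℕ.divides q refl) with y₁ , y₂ , y₃ , y₄ , q≡ ← lagrange-four-squares q =
    combine (pair-zero-or-p-times y₁ y₂) (pair-zero-or-p-times y₃ y₄)
    where
    open ≡-Reasoning
    n≡ : + (q ℕ.* p) ≡ P * (y₁ * y₁ + y₂ * y₂) + P * (y₃ * y₃ + y₄ * y₄)
    n≡ = begin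
      + (q ℕ.* p)                                             ≡⟨ ℤ.pos-* q p ⟩
      + q * P                                                 ≡⟨ cong (_* P) q≡ ⟩
      (y₁ * y₁ + y₂ * y₂ + y₃ * y₃ + y₄ * y₄) * P             ≡⟨ distribute P y₁ y₂ y₃ y₄ ⟩
      P * (y₁ * y₁ + y₂ * y₂) + P * (y₃ * y₃ + y₄ * y₄)       ∎
      where
      distribute : ∀ P a b c d → (a * a + b * b + c * c + d * d) * P ≡ P * (a * a + b * b) + P * (c * c + d * d)
      distribute = solve-∀
    zero-pair : ∀ X → P * (+ 0 * + 0 + + 0 * + 0) + X ≡ X
    zero-pair X = trans (cong (_+ X) (ℤ.*-zeroʳ P)) (ℤ.+-identityˡ X)
    combine : (y₁ ≡ + 0 × y₂ ≡ + 0) ⊎ SumOfTwoSquaresNotDivBy (P * (y₁ * y₁ + y₂ * y₂)) →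
              (y₃ ≡ + 0 × y₄ ≡ + 0) ⊎ SumOfTwoSquaresNotDivBy (P * (y₃ * y₃ + y₄ * y₄)) →
              ∃ λ k → 1 ℕ.≤ k × k ℕ.≤ 4 × SumOfSquaresNotDivBy p k (+ (q ℕ.* p))
    combine (inj₁ (refl , refl)) (inj₁ (refl , refl)) =
      contradiction (ℤ.+-injective (trans n≡ (trans (zero-pair _) (ℤ.*-zeroʳ P)))) (ℕ.<⇒≢ 1≤n ∘ sym)
    combine (inj₁ (refl , refl)) (inj₂ r₃₄) = 2 , s≤s z≤n , s≤s (s≤s z≤n) ,
      subst (SumOfSquaresNotDivBy p 2) (sym (trans n≡ (zero-pair _))) (sumOfSquaresNotDivBy₂ r₃₄)
    combine (inj₂ r₁₂) (inj₁ (refl , refl)) = 2 , s≤s z≤n , s≤s (s≤s z≤n) ,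
      subst (SumOfSquaresNotDivBy p 2) (sym (trans n≡ (trans (ℤ.+-comm (P * (y₁ * y₁ + y₂ * y₂)) _) (zero-pair _)))) (sumOfSquaresNotDivBy₂ r₁₂)
    combine (inj₂ r₁₂) (inj₂ r₃₄) = 4 , s≤s z≤n , ℕ.≤-refl ,
      subst (SumOfSquaresNotDivBy p 4) (sym n≡) (sumOfSquaresNotDivBy₄ r₁₂ r₃₄)

open import Data.Nat using (ℕ; _≤_; _%_)
open import Data.Nat.Divisibility using (_∣_)
open import Data.Integer using (+_)

proposition3p3 : (p n : ℕ) → Prime p → p % 4 ≡ 1 → 1 ≤ n → p ∣ n →
    ∃ λ k → (1 ≤ k) × (k ≤ 4) × SumOfSquaresNotDivBy p k (+ n)
proposition3p3 p n p-prime p%4≡1 1≤n p∣n = from-two-squares (Windmill.fermat-two-squares {k = p ℕ./ 4} p-prime p≡1+4[p/4])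
  where
  p≡1+4[p/4] : p ≡ suc (4 ℕ.* (p ℕ./ 4))
  p≡1+4[p/4] = trans (ℕ.m≡m%n+[m/n]*n p 4) (cong₂ ℕ._+_ p%4≡1 (ℕ.*-comm (p ℕ./ 4) 4))
  p≢2 : p ≢ 2
  p≢2 p≡2 = contradiction (trans (cong (_% 4) (sym p≡2)) p%4≡1) λ ()
  from-two-squares : (∃₂ λ a b → p ≡ a ℕ.* a ℕ.+ b ℕ.* b) → ∃ λ k → (1 ≤ k) × (k ≤ 4) × SumOfSquaresNotDivBy p k (+ n)
  from-two-squares (a , b , p≡a²+b²) = MultiplesOfPrime.positive-multiple⇒sumOfSquaresNotDivBy p-prime p≢2 {+ a} {+ b}
    (trans (cong +_ p≡a²+b²) (FourSquares.pos-sum-of-two-squares a b)) 1≤n p∣n
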